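{- Let $D$ be a digraph such that for every pair $R, Q$ of distinct strong components of $D$, if there is an arc from a vertex of $R$ to a vertex of $Q$, then every vertex of $Q$ has an in-neighbor in $R$. Then $D \in \mathcal{L}$, i.e. either $\ell_s(D)=0$ or $\ell_s(D)=\ell(D)$.
   Context: Digraphs are finite. An out-tree of a digraph $D$ is a subdigraph $T$ that is an oriented tree with exactly one vertex of in-degree zero (the root); its leaves are its vertices of out-degree zero. An out-branching of $D$ is an out-tree $T$ with $V(T)=V(D)$. $\ell(D)$ denotes the maximum number of leaves of an out-tree of $D$, and $\ell_s(D)$ denotes the maximum number of leaves of an out-branching of $D$, with $\ell_s(D)=0$ if $D$ has no out-branching. $\mathcal{L}$ is the family of digraphs $D$ for which either $\ell_s(D)=0$ or $\ell_s(D)=\ell(D)$. -}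

module Defs where

open import Data.Nat using (ℕ; zero; suc; _+_; _≤_)
open import Data.Fin using (Fin; zero; suc)
open import Data.Bool using (Bool; true; false; T; not; _∧_; _∨_; if_then_else_)
open import Data.Product using (Σ; _×_; _,_; ∃)
open import Data.Sum using (_⊎_)
open import Relation.Nullary using (¬_)
open import Relation.Binary.PropositionalEquality using (_≡_)

record Digraph : Set where
  field
    n   : ℕ
    arc : Fin n → Fin n → Bool
open Digraph public

count : ∀ {n} → (Fin n → Bool) → ℕ
count {zero}  f = 0
count {suc n} f = (if f zero then 1 else 0) + count (λ i → f (suc i))

anyFin : ∀ {n} → (Fin n → Bool) → Bool
anyFin {zero}  f = false
anyFin {suc n} f = f zero ∨ anyFin (λ i → f (suc i))

data Reach (D : Digraph) : Fin (n D) → Fin (n D) → Set where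
  here : ∀ {u} → Reach D u u
  step : ∀ {u w v} → T (arc D u w) → Reach D w v → Reach D u v

SameComp : (D : Digraph) → Fin (n D) → Fin (n D) → Set
SameComp D u v = Reach D u v × Reach D v u

data UWalk {m : ℕ} (A : Fin m → Fin m → Bool) : Fin m → Fin m → Set where
  here : ∀ {u} → UWalk A u u
  fwd  : ∀ {u w v} → T (A u w) → UWalk A w v → UWalk A u v
  bwd  : ∀ {u w v} → T (A w u) → UWalk A w v → UWalk A u v

sumFin : ∀ {m} → (Fin m → ℕ) → ℕ
sumFin {zero}  f = 0
sumFin {suc m} f = f zero + sumFin (λ i → f (suc i))

arcCount : ∀ {m} → (Fin m → Fin m → Bool) → ℕ
arcCount A = sumFin (λ i → count (A i))

InDeg0 : ∀ {m} → (Fin m → Fin m → Bool) → Fin m → Set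
InDeg0 A v = ∀ u → A u v ≡ false

outDeg0 : ∀ {m} → (Fin m → Fin m → Bool) → Fin m → Bool
outDeg0 A v = not (anyFin (A v))

record OutTree (D : Digraph) : Set where
  field
    S   : Fin (n D) → Bool
    A   : Fin (n D) → Fin (n D) → Bool
    A⊆D     : ∀ i j → T (A i j) → T (arc D i j)
    A-tail  : ∀ i j → T (A i j) → T (S i)
    A-head  : ∀ i j → T (A i j) → T (S j)
    noLoop  : ∀ i → A i i ≡ false
    noDigon : ∀ i j → T (A i j) → A j i ≡ false
    -- underlying graph is a tree: connected and |E| = |V| - 1
    connected : ∀ u v → T (S u) → T (S v) → UWalk A u v
    edges     : arcCount A + 1 ≡ count S
    root       : Fin (n D)
    root∈S     : T (S root)
    rootInDeg0 : InDeg0 A root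
    rootUnique : ∀ v → T (S v) → InDeg0 A v → v ≡ root
open OutTree public

leaves : ∀ {D} → OutTree D → ℕ
leaves T' = count (λ v → S T' v ∧ outDeg0 (A T') v)

IsOutBranching : ∀ {D} → OutTree D → Set
IsOutBranching T' = ∀ v → T (S T' v)

ℓ≡ : Digraph → ℕ → Set
ℓ≡ D k = (Σ (OutTree D) λ T' → leaves T' ≡ k)
       × (∀ (T' : OutTree D) → leaves T' ≤ k)

ℓₛ≡ : Digraph → ℕ → Set
ℓₛ≡ D k = ((¬ Σ (OutTree D) IsOutBranching) × k ≡ 0)
        ⊎ ((Σ (OutTree D) λ T' → IsOutBranching T' × leaves T' ≡ k)
           × (∀ (T' : OutTree D) → IsOutBranching T' → leaves T' ≤ k))

In𝓛 : Digraph → Set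
In𝓛 D = ∀ s k → ℓₛ≡ D s → ℓ≡ D k → s ≡ 0 ⊎ s ≡ k

ComponentCondition : Digraph → Set
ComponentCondition D =
  ∀ u v → T (arc D u v) → ¬ SameComp D u v →
  ∀ w → SameComp D v w → ∃ λ x → SameComp D u x × T (arc D x w)

-- An out-tree with ℓ(D) leaves can be grown into an out-branching without losing leaves,
-- so ℓ(D) ≤ ℓₛ(D) ≤ ℓ(D) as soon as D has an out-branching B.  While a vertex is missing
-- from the tree T: if some arc leaves V(T), its head becomes a new leaf (its tail may stop
-- being one, so the number of leaves does not drop).  Otherwise V(T) is closed under arcs,
-- hence the root of B lies outside V(T), and a path of B from its root to the root r of T
-- enters V(T) by an arc uv.  Closedness puts u and v in different strong components, while
-- v and r are strongly connected (v reaches r along the path, r reaches v in T).  So the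
-- hypothesis gives an in-neighbour x of r in the component of u; x ∉ V(T) by closedness
-- again, and the arc xr makes x the new root without changing any leaf.

{-# OPTIONS --safe #-}
module Submission where

open import Defs
open import Data.Bool using (Bool; true; false; T; not; _∧_; _∨_; if_then_else_)
open import Data.Bool.Properties using (T-∧; T-∨; T-not-≡; T-≡; ∨-identityʳ; ∧-identityʳ)
open import Data.Empty using (⊥; ⊥-elim)
open import Data.Fin using (Fin; zero; suc)
open import Data.Fin.Properties using (_≟_; any?; all?; ¬∀⟶∃¬) renaming (suc-injective to Fin-suc-injective)
open import Data.Nat using (ℕ; zero; suc; _+_; _≤_; _<_; z≤n; s≤s)
open import Data.Nat.Induction using (<-wellFounded)
open import Data.Nat.Properties
  using (≤-refl; ≤-reflexive; ≤-trans; ≤-antisym; +-mono-≤; +-mono-<-≤; +-mono-≤-<; +-suc; +-comm;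
         m≤m+n; m≤n+m; ≤-<-trans; suc-injective; ≮⇒≥; <-irrefl; +-0-commutativeMonoid; module ≤-Reasoning)
open import Algebra.Properties.CommutativeMonoid.Sum +-0-commutativeMonoid using (sum; sum-cong-≗; ∑-comm)
open import Data.Product using (Σ; ∃; ∃₂; _×_; _,_; proj₁; proj₂)
open import Data.Sum using (_⊎_; inj₁; inj₂; [_,_])
import Data.Sum as Sum
open import Function using (_∘_; Equivalence)
open import Induction.WellFounded using (Acc; acc)
open import Relation.Binary.PropositionalEquality
  using (_≡_; _≢_; refl; sym; trans; cong; cong₂; subst; module ≡-Reasoning)
open import Relation.Nullary using (¬_; yes; no)
open import Relation.Nullary.Decidable
  using (⌊_⌋; T?; _×-dec_; ¬?; toWitness; fromWitness; decidable-stable)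

open Equivalence using (to; from)

private
  variable
    m : ℕ
    X : Fin m → Bool
    E : Fin m → Fin m → Bool
    i j u v w : Fin m

¬T⇒≡false : ∀ {b} → ¬ T b → b ≡ false
¬T⇒≡false {false} _ = refl
¬T⇒≡false {true} b∉ = ⊥-elim (b∉ _)

≡false⇒¬T : ∀ {b} → b ≡ false → ¬ T b
≡false⇒¬T refl ()

𝟙 : Bool → ℕ
𝟙 b = if b then 1 else 0

𝟙-mono : ∀ {a b} → (T a → T b) → 𝟙 a ≤ 𝟙 b
𝟙-mono {false} _ = z≤n
𝟙-mono {true} {true} _ = ≤-refl
𝟙-mono {true} {false} a⇒b = ⊥-elim (a⇒b _)

𝟙≤1 : ∀ b → 𝟙 b ≤ 1
𝟙≤1 false = z≤n
𝟙≤1 true = ≤-refl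

sumFin≡sum : (f : Fin m → ℕ) → sumFin f ≡ sum f
sumFin≡sum {zero} f = refl
sumFin≡sum {suc m} f = cong (f zero +_) (sumFin≡sum (f ∘ suc))

sum-mono : {f g : Fin m → ℕ} → (∀ i → f i ≤ g i) → sum f ≤ sum g
sum-mono {zero} f≤g = z≤n
sum-mono {suc m} f≤g = +-mono-≤ (f≤g zero) (sum-mono (f≤g ∘ suc))

sum-< : {f g : Fin m → ℕ} → (∀ i → f i ≤ g i) → ∀ a → f a < g a → sum f < sum g
sum-< {suc m} f≤g zero fa<ga = +-mono-<-≤ fa<ga (sum-mono (f≤g ∘ suc))
sum-< {suc m} f≤g (suc a) fa<ga = +-mono-≤-< (f≤g zero) (sum-< (f≤g ∘ suc) a fa<ga)

sum-update : {f g : Fin m → ℕ} (a : Fin m) →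
  (∀ i → i ≢ a → f i ≡ g i) → g a ≡ suc (f a) → sum g ≡ suc (sum f)
sum-update {suc m} zero f≡g ga≡ =
  cong₂ _+_ ga≡ (sym (sum-cong-≗ (λ i → f≡g (suc i) λ ())))
sum-update {suc m} {f} {g} (suc a) f≡g ga≡ = begin
  g zero + sum (g ∘ suc)        ≡⟨ cong₂ _+_ (sym (f≡g zero λ ())) (sum-update a f≡g′ ga≡) ⟩
  f zero + suc (sum (f ∘ suc))  ≡⟨ +-suc (f zero) _ ⟩
  suc (sum f)                   ∎
  where
  open ≡-Reasoning
  f≡g′ : ∀ i → i ≢ a → f (suc i) ≡ g (suc i)
  f≡g′ i i≢a = f≡g (suc i) (i≢a ∘ Fin-suc-injective)

count≡sum : (f : Fin m → Bool) → count f ≡ sum (𝟙 ∘ f)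
count≡sum {zero} f = refl
count≡sum {suc m} f = cong (𝟙 (f zero) +_) (count≡sum (f ∘ suc))

count-cong : {f g : Fin m → Bool} → (∀ i → f i ≡ g i) → count f ≡ count g
count-cong {zero} f≡g = refl
count-cong {suc m} f≡g = cong₂ _+_ (cong 𝟙 (f≡g zero)) (count-cong (f≡g ∘ suc))

count-mono : {f g : Fin m → Bool} → (∀ i → T (f i) → T (g i)) → count f ≤ count g
count-mono {zero} f⊆g = z≤n
count-mono {suc m} f⊆g = +-mono-≤ (𝟙-mono (f⊆g zero)) (count-mono (f⊆g ∘ suc))

count-pos : {f : Fin m → Bool} (a : Fin m) → T (f a) → 0 < count f
count-pos {f = f} zero fa = ≤-trans (𝟙-mono {true} λ _ → fa) (m≤m+n (𝟙 (f zero)) _)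
count-pos {f = f} (suc a) fa = ≤-trans (count-pos a fa) (m≤n+m _ (𝟙 (f zero)))

𝟙-≤-count : ∀ {b} {f : Fin m → Bool} → (T b → ∃ λ i → T (f i)) → 𝟙 b ≤ count f
𝟙-≤-count {b = false} _ = z≤n
𝟙-≤-count {b = true} witness = count-pos (proj₁ (witness _)) (proj₂ (witness _))

count-update : {f g : Fin m → Bool} (a : Fin m) →
  (∀ i → i ≢ a → f i ≡ g i) → ¬ T (f a) → T (g a) → count g ≡ suc (count f)
count-update {f = f} {g} a f≡g fa∉ ga∈ = begin
  count g            ≡⟨ count≡sum g ⟩
  sum (𝟙 ∘ g)        ≡⟨ sum-update a (λ i i≢a → cong 𝟙 (f≡g i i≢a)) 𝟙-flip ⟩
  suc (sum (𝟙 ∘ f))  ≡⟨ cong suc (sym (count≡sum f)) ⟩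
  suc (count f)      ∎
  where
  open ≡-Reasoning
  𝟙-flip : 𝟙 (g a) ≡ suc (𝟙 (f a))
  𝟙-flip rewrite ¬T⇒≡false fa∉ | T-≡ .to ga∈ = refl

-- Opaque, so that unification sees `X ∪｛ w ｝` rather than its unfolding.
opaque
  _∪｛_｝ : (Fin m → Bool) → Fin m → Fin m → Bool
  (X ∪｛ w ｝) i = X i ∨ ⌊ i ≟ w ⌋

  _∖｛_｝ : (Fin m → Bool) → Fin m → Fin m → Bool
  (X ∖｛ w ｝) i = X i ∧ not ⌊ i ≟ w ⌋

  ∪-here : T ((X ∪｛ w ｝) w)
  ∪-here {X = X} {w = w} = T-∨ {X w} .from (inj₂ (fromWitness refl))

  ∪-old : T (X i) → T ((X ∪｛ w ｝) i)
  ∪-old = T-∨ .from ∘ inj₁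

  ∪-elim : T ((X ∪｛ w ｝) i) → T (X i) ⊎ i ≡ w
  ∪-elim = Sum.map₂ toWitness ∘ T-∨ .to

  ∪-≢ : i ≢ w → (X ∪｛ w ｝) i ≡ X i
  ∪-≢ {i = i} {w} {X} i≢w with i ≟ w
  ... | yes i≡w = ⊥-elim (i≢w i≡w)
  ... | no _ = ∨-identityʳ (X i)

  ∖-intro : T (X i) → i ≢ w → T ((X ∖｛ w ｝) i)
  ∖-intro Xi i≢w = T-∧ .from (Xi , T-not-≡ .from (¬T⇒≡false (i≢w ∘ toWitness)))

  ∖-elim : T ((X ∖｛ w ｝) i) → T (X i) × i ≢ w
  ∖-elim {X = X} {i = i} h with T-∧ {X i} .to h
  ... | Xi , i≢w = Xi , λ i≡w → ≡false⇒¬T (T-not-≡ .to i≢w) (fromWitness i≡w)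

  ∖-≢ : i ≢ w → (X ∖｛ w ｝) i ≡ X i
  ∖-≢ {i = i} {w} {X} i≢w with i ≟ w
  ... | yes i≡w = ⊥-elim (i≢w i≡w)
  ... | no _ = ∧-identityʳ (X i)

  ∖-here : ¬ T ((X ∖｛ w ｝) w)
  ∖-here {X = X} h = proj₂ (∖-elim {X = X} h) refl

count-∪ : (X : Fin m → Bool) {w : Fin m} → ¬ T (X w) → count (X ∪｛ w ｝) ≡ suc (count X)
count-∪ X {w} w∉ = count-update w (λ i i≢w → sym (∪-≢ {X = X} i≢w)) w∉ (∪-here {X = X})

count-∖ : (X : Fin m → Bool) {w : Fin m} → T (X w) → count X ≡ suc (count (X ∖｛ w ｝))
count-∖ X {w} w∈ = count-update w (λ i i≢w → ∖-≢ {X = X} i≢w) (∖-here {X = X}) w∈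

count-not-∪ : (X : Fin m → Bool) {w : Fin m} → ¬ T (X w) →
  suc (count (not ∘ (X ∪｛ w ｝))) ≡ count (not ∘ X)
count-not-∪ X {w} w∉ = sym (count-update w (λ i i≢w → cong not (∪-≢ {X = X} i≢w))
  (λ h → ≡false⇒¬T (T-not-≡ .to h) (∪-here {X = X})) (T-not-≡ .from (¬T⇒≡false w∉)))

count≤1⇒≡ : {f : Fin m → Bool} {a b : Fin m} → count f ≤ 1 → T (f a) → T (f b) → a ≡ b
count≤1⇒≡ {f = f} {a} {b} count≤1 fa fb = decidable-stable (a ≟ b) λ a≢b →
  <-irrefl refl (begin-strict
    1                      ≤⟨ count-pos b (∖-intro {X = f} fb (a≢b ∘ sym)) ⟩
    count (f ∖｛ a ｝)      <⟨ ≤-reflexive (sym (count-∖ f fa)) ⟩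
    count f                ≤⟨ count≤1 ⟩
    1                      ∎)
  where open ≤-Reasoning

count-exchange : {f g : Fin m → Bool} {a b : Fin m} →
  (∀ i → i ≢ a → T (f i) → T (g i)) → ¬ T (f b) → T (g b) → count f ≤ count g
count-exchange {f = f} {g} {a} {b} f⊆g fb∉ gb∈ with T? (f a)
... | no fa∉ = count-mono λ i fi → f⊆g i (λ { refl → fa∉ fi }) fi
... | yes fa∈ = begin
  count f                  ≡⟨ count-∖ f fa∈ ⟩
  suc (count (f ∖｛ a ｝))  ≤⟨ s≤s (count-mono f∖a⊆g∖b) ⟩
  suc (count (g ∖｛ b ｝))  ≡⟨ sym (count-∖ g gb∈) ⟩
  count g                  ∎
  where
  open ≤-Reasoning
  f∖a⊆g∖b : ∀ i → T ((f ∖｛ a ｝) i) → T ((g ∖｛ b ｝) i)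
  f∖a⊆g∖b i fi∖a with ∖-elim {X = f} fi∖a
  ... | fi , i≢a = ∖-intro {X = g} (f⊆g i i≢a fi) λ { refl → fb∉ fi }

opaque
  unfolding _∪｛_｝

  _∪｛_⇒_｝ : (Fin m → Fin m → Bool) → Fin m → Fin m → Fin m → Fin m → Bool
  (E ∪｛ u ⇒ v ｝) i j = E i j ∨ (⌊ i ≟ u ⌋ ∧ ⌊ j ≟ v ⌋)

  ⇒-here : T ((E ∪｛ u ⇒ v ｝) u v)
  ⇒-here {E = E} {u} {v} =
    T-∨ {E u v} .from (inj₂ (T-∧ .from (fromWitness {a? = u ≟ u} refl , fromWitness {a? = v ≟ v} refl)))

  ⇒-old : T (E i j) → T ((E ∪｛ u ⇒ v ｝) i j)
  ⇒-old = T-∨ .from ∘ inj₁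

  ⇒-elim : T ((E ∪｛ u ⇒ v ｝) i j) → T (E i j) ⊎ (i ≡ u × j ≡ v)
  ⇒-elim {E = E} {i = i} {j = j} h with T-∨ {E i j} .to h
  ... | inj₁ Eij = inj₁ Eij
  ... | inj₂ new with T-∧ {⌊ i ≟ _ ⌋} .to new
  ...   | i≡u , j≡v = inj₂ (toWitness i≡u , toWitness j≡v)

  ⇒-row : i ≢ u → ∀ j → (E ∪｛ u ⇒ v ｝) i j ≡ E i j
  ⇒-row {i = i} {u = u} {E = E} i≢u j with i ≟ u
  ... | yes i≡u = ⊥-elim (i≢u i≡u)
  ... | no _ = ∨-identityʳ (E i j)

  ⇒-row-here : ∀ j → (E ∪｛ u ⇒ v ｝) u j ≡ (E u ∪｛ v ｝) j
  ⇒-row-here {u = u} j with u ≟ u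
  ... | yes _ = refl
  ... | no u≢u = ⊥-elim (u≢u refl)

module _ {E : Fin m → Fin m → Bool} {u v : Fin m} where

  InDeg0-∪ : ∀ {r} → InDeg0 E r → r ≢ v → InDeg0 (E ∪｛ u ⇒ v ｝) r
  InDeg0-∪ r-source r≢v y = ¬T⇒≡false ([ ≡false⇒¬T (r-source y) , (λ (_ , r≡v) → r≢v r≡v) ] ∘ ⇒-elim)

  InDeg0-∪⁻ : ∀ {r} → InDeg0 (E ∪｛ u ⇒ v ｝) r → InDeg0 E r
  InDeg0-∪⁻ r-source y = ¬T⇒≡false (≡false⇒¬T (r-source y) ∘ ⇒-old)

  arcCount-∪ : ¬ T (E u v) → arcCount (E ∪｛ u ⇒ v ｝) ≡ suc (arcCount E)
  arcCount-∪ uv∉ = begin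
    sumFin (count ∘ (E ∪｛ u ⇒ v ｝))  ≡⟨ sumFin≡sum (count ∘ (E ∪｛ u ⇒ v ｝)) ⟩
    sum (count ∘ (E ∪｛ u ⇒ v ｝))     ≡⟨ sum-update u other-rows row-u ⟩
    suc (sum (count ∘ E))              ≡⟨ cong suc (sym (sumFin≡sum (count ∘ E))) ⟩
    suc (sumFin (count ∘ E))           ∎
    where
    open ≡-Reasoning
    other-rows : ∀ i → i ≢ u → count (E i) ≡ count ((E ∪｛ u ⇒ v ｝) i)
    other-rows i i≢u = sym (count-cong (⇒-row {i = i} i≢u))
    row-u : count ((E ∪｛ u ⇒ v ｝) u) ≡ suc (count (E u))
    row-u = trans (count-cong (⇒-row-here {E = E})) (count-∪ (E u) uv∉)

inDegree : (Fin m → Fin m → Bool) → Fin m → ℕ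
inDegree E j = count (λ i → E i j)

arcCount≡∑inDegree : (E : Fin m → Fin m → Bool) → arcCount E ≡ sum (inDegree E)
arcCount≡∑inDegree E = begin
  sumFin (count ∘ E)                        ≡⟨ sumFin≡sum (count ∘ E) ⟩
  sum (count ∘ E)                           ≡⟨ sum-cong-≗ (count≡sum ∘ E) ⟩
  sum (λ i → sum (λ j → 𝟙 (E i j)))         ≡⟨ ∑-comm (λ i j → 𝟙 (E i j)) ⟩
  sum (λ j → sum (λ i → 𝟙 (E i j)))         ≡⟨ sum-cong-≗ (λ j → sym (count≡sum (λ i → E i j))) ⟩
  sum (inDegree E)                          ∎
  where open ≡-Reasoning

anyFin-intro : {f : Fin m → Bool} (i : Fin m) → T (f i) → T (anyFin f)
anyFin-intro {f = f} zero fi = T-∨ {f zero} .from (inj₁ fi)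
anyFin-intro {f = f} (suc i) fi = T-∨ {f zero} .from (inj₂ (anyFin-intro i fi))

anyFin-elim : {f : Fin m → Bool} → T (anyFin f) → ∃ λ i → T (f i)
anyFin-elim {suc m} {f} h with T-∨ {f zero} .to h
... | inj₁ f0 = zero , f0
... | inj₂ rest with anyFin-elim rest
...   | i , fi = suc i , fi

module _ {E : Fin m → Fin m → Bool} {v : Fin m} where

  outDeg0-intro : (∀ j → ¬ T (E v j)) → T (outDeg0 E v)
  outDeg0-intro noArc = T-not-≡ .from (¬T⇒≡false λ some → noArc _ (proj₂ (anyFin-elim {f = E v} some)))

  outDeg0-elim : T (outDeg0 E v) → ∀ j → ¬ T (E v j)
  outDeg0-elim out j Evj = ≡false⇒¬T (T-not-≡ {anyFin (E v)} .to out) (anyFin-intro j Evj)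

isLeaf : (Fin m → Bool) → (Fin m → Fin m → Bool) → Fin m → Bool
isLeaf X E v = X v ∧ outDeg0 E v

isLeaf-∪ : i ≢ u → T (isLeaf X E i) → T (isLeaf (X ∪｛ w ｝) (E ∪｛ u ⇒ v ｝) i)
isLeaf-∪ {i = i} {u = u} {X = X} {E = E} {w = w} {v = v} i≢u leaf with T-∧ {X i} .to leaf
... | Xi , out = T-∧ .from (∪-old {X = X} {w = w} Xi , outDeg0-intro {E = E ∪｛ u ⇒ v ｝} λ j Eij →
  [ outDeg0-elim {E = E} out j , (λ (i≡u , _) → ⊥-elim (i≢u i≡u)) ] (⇒-elim {E = E} Eij))

module _ {E : Fin m → Fin m → Bool} where

  _++_ : ∀ {a b c} → UWalk E a b → UWalk E b c → UWalk E a c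
  here ++ q = q
  fwd ab p ++ q = fwd ab (p ++ q)
  bwd ba p ++ q = bwd ba (p ++ q)

  reverse : ∀ {a b} → UWalk E a b → UWalk E b a
  reverse here = here
  reverse (fwd ab p) = reverse p ++ bwd ab here
  reverse (bwd ba p) = reverse p ++ fwd ba here

UWalk-map : {E E′ : Fin m → Fin m → Bool} → (∀ {i j} → T (E i j) → T (E′ i j)) →
  ∀ {a b} → UWalk E a b → UWalk E′ a b
UWalk-map E⊆E′ here = here
UWalk-map E⊆E′ (fwd ab p) = fwd (E⊆E′ ab) (UWalk-map E⊆E′ p)
UWalk-map E⊆E′ (bwd ba p) = bwd (E⊆E′ ba) (UWalk-map E⊆E′ p)

Reach-snoc : ∀ {D a b c} → Reach D a b → T (arc D b c) → Reach D a c
Reach-snoc here bc = step bc here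
Reach-snoc (step ab p) bc = step ab (Reach-snoc p bc)

Closed : (D : Digraph) → (Fin (n D) → Bool) → Set
Closed D X = ∀ {a b} → T (X a) → T (arc D a b) → T (X b)

module _ {D : Digraph} {X : Fin (n D) → Bool} where

  Reach-closed : Closed D X → ∀ {a b} → Reach D a b → T (X a) → T (X b)
  Reach-closed closed here a∈ = a∈
  Reach-closed closed (step ab p) a∈ = Reach-closed closed p (closed a∈ ab)

  entering-arc : ∀ {a b} → Reach D a b → ¬ T (X a) → T (X b) →
    ∃₂ λ u v → ¬ T (X u) × T (X v) × T (arc D u v) × Reach D v b
  entering-arc here a∉ a∈ = ⊥-elim (a∉ a∈)
  entering-arc (step {w = w} aw w↝b) a∉ b∈ with T? (X w)
  ... | yes w∈ = _ , w , a∉ , w∈ , aw , w↝b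
  ... | no w∉ = entering-arc w↝b w∉ b∈

  leaving-arc-or-closed : (∃₂ λ u v → T (X u) × ¬ T (X v) × T (arc D u v)) ⊎ Closed D X
  leaving-arc-or-closed with any? (λ u → any? λ v → T? (X u) ×-dec ¬? (T? (X v)) ×-dec T? (arc D u v))
  ... | yes (u , v , leaving) = inj₁ (u , v , leaving)
  ... | no none = inj₂ λ {a} {b} a∈ ab → decidable-stable (T? (X b)) λ b∉ → none (a , b , a∈ , b∉ , ab)

module _ {D : Digraph} (t : OutTree D) where

  has-parent : ∀ {v} → T ((S t ∖｛ root t ｝) v) → ∃ λ p → T (A t p v)
  has-parent {v} v∈ with ∖-elim {X = S t} v∈ | any? (λ p → T? (A t p v))
  ... | _ | yes parent = parent
  ... | v∈S , v≢r | no orphan =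
    ⊥-elim (v≢r (rootUnique t v v∈S λ p → ¬T⇒≡false λ pv → orphan (p , pv)))

  count-nonroot≡arcCount : count (S t ∖｛ root t ｝) ≡ arcCount (A t)
  count-nonroot≡arcCount = suc-injective (begin
    suc (count (S t ∖｛ root t ｝))  ≡⟨ count-∖ (S t) (root∈S t) ⟨
    count (S t)                     ≡⟨ edges t ⟨
    arcCount (A t) + 1              ≡⟨ +-comm _ 1 ⟩
    suc (arcCount (A t))            ∎)
    where open ≡-Reasoning

  -- The in-degrees sum to arcCount (A t) = |V(t)| − 1, and each non-root vertex has in-degree ≥ 1.
  inDegree≤1 : ∀ v → inDegree (A t) v ≤ 1
  inDegree≤1 v = ≮⇒≥ λ 1<deg → <-irrefl refl (begin-strict
    count (S t ∖｛ root t ｝)          ≡⟨ count≡sum (S t ∖｛ root t ｝) ⟩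
    sum (𝟙 ∘ (S t ∖｛ root t ｝))      <⟨ sum-< nonroot≤inDegree v (≤-<-trans (𝟙≤1 _) 1<deg) ⟩
    sum (inDegree (A t))              ≡⟨ arcCount≡∑inDegree (A t) ⟨
    arcCount (A t)                    ≡⟨ count-nonroot≡arcCount ⟨
    count (S t ∖｛ root t ｝)          ∎)
    where
    open ≤-Reasoning
    nonroot≤inDegree : ∀ j → 𝟙 ((S t ∖｛ root t ｝) j) ≤ inDegree (A t) j
    nonroot≤inDegree j = 𝟙-≤-count has-parent

  parent-unique : ∀ {p q v} → T (A t p v) → T (A t q v) → p ≡ q
  parent-unique {v = v} = count≤1⇒≡ (inDegree≤1 v)

  data FromRoot : Fin (n D) → Set where
    atRoot : FromRoot (root t)
    _▸_ : ∀ {p v} → FromRoot p → T (A t p v) → FromRoot v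

  -- A backward step of an undirected walk can only lead to the unique parent.
  FromRoot-walk : ∀ {a b} → FromRoot a → UWalk (A t) a b → FromRoot b
  FromRoot-walk π here = π
  FromRoot-walk π (fwd ab p) = FromRoot-walk (π ▸ ab) p
  FromRoot-walk atRoot (bwd {w = w} wr p) = ⊥-elim (≡false⇒¬T (rootInDeg0 t w) wr)
  FromRoot-walk (π ▸ pa) (bwd wa q) with parent-unique pa wa
  ... | refl = FromRoot-walk π q

  FromRoot⇒Reach : ∀ {v} → FromRoot v → Reach D (root t) v
  FromRoot⇒Reach atRoot = here
  FromRoot⇒Reach (π ▸ pv) = Reach-snoc (FromRoot⇒Reach π) (A⊆D t _ _ pv)

  root-reaches : ∀ {v} → T (S t v) → Reach D (root t) v
  root-reaches v∈ = FromRoot⇒Reach (FromRoot-walk atRoot (connected t _ _ (root∈S t) v∈))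

-- Grafting a new vertex onto an out-tree

module _ {D : Digraph} where

  data Graft (t : OutTree D) (w : Fin (n D)) : Fin (n D) → Fin (n D) → Set where
    asLeaf : ∀ {o} → T (S t o) → Graft t w o w
    asRoot : Graft t w w (root t)

  module _ {t : OutTree D} {w : Fin (n D)} where

    old-end : ∀ {u v} → Graft t w u v → Fin (n D)
    old-end (asLeaf {o} _) = o
    old-end asRoot = root t

    old-end∈ : ∀ {u v} (g : Graft t w u v) → T (S t (old-end g))
    old-end∈ (asLeaf o∈) = o∈
    old-end∈ asRoot = root∈S t

    link : ∀ {u v} (g : Graft t w u v) → UWalk (A t ∪｛ u ⇒ v ｝) w (old-end g)
    link (asLeaf _) = bwd ⇒-here here
    link asRoot = fwd ⇒-here here

    ends∈ : ∀ {u v} → Graft t w u v → T ((S t ∪｛ w ｝) u) × T ((S t ∪｛ w ｝) v)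
    ends∈ (asLeaf o∈) = ∪-old o∈ , ∪-here
    ends∈ asRoot = ∪-here , ∪-old (root∈S t)

    graft-root : ∀ {u v} → Graft t w u v → Fin (n D)
    graft-root (asLeaf _) = root t
    graft-root asRoot = w

    graft-root∈ : ∀ {u v} (g : Graft t w u v) → T ((S t ∪｛ w ｝) (graft-root g))
    graft-root∈ (asLeaf _) = ∪-old (root∈S t)
    graft-root∈ asRoot = ∪-here

    module _ (w∉ : ¬ T (S t w)) where

      root≢w : root t ≢ w
      root≢w r≡w = w∉ (subst (T ∘ S t) r≡w (root∈S t))

      not-both-old : ∀ {u v} → Graft t w u v → T (S t u) → T (S t v) → ⊥
      not-both-old (asLeaf _) _ w∈ = w∉ w∈
      not-both-old asRoot w∈ _ = w∉ w∈

      ends-≢ : ∀ {u v} → Graft t w u v → u ≢ v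
      ends-≢ (asLeaf o∈) refl = w∉ o∈
      ends-≢ asRoot w≡r = root≢w (sym w≡r)

      graft-rootInDeg0 : ∀ {u v} (g : Graft t w u v) → InDeg0 (A t ∪｛ u ⇒ v ｝) (graft-root g)
      graft-rootInDeg0 (asLeaf _) = InDeg0-∪ (rootInDeg0 t) root≢w
      graft-rootInDeg0 asRoot = InDeg0-∪ (λ y → ¬T⇒≡false (w∉ ∘ A-head t y w)) (root≢w ∘ sym)

      graft-rootUnique : ∀ {u v} (g : Graft t w u v) → ∀ y → T ((S t ∪｛ w ｝) y) →
        InDeg0 (A t ∪｛ u ⇒ v ｝) y → y ≡ graft-root g
      graft-rootUnique g y y∈ y-source with ∪-elim {X = S t} y∈ | g
      ... | inj₁ y∈S | asLeaf _ = rootUnique t y y∈S (InDeg0-∪⁻ y-source)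
      ... | inj₂ refl | asLeaf _ = ⊥-elim (≡false⇒¬T (y-source _) ⇒-here)
      ... | inj₂ refl | asRoot = refl
      ... | inj₁ y∈S | asRoot with rootUnique t y y∈S (InDeg0-∪⁻ y-source)
      ...   | refl = ⊥-elim (≡false⇒¬T (y-source w) ⇒-here)

  missing : OutTree D → ℕ
  missing t = count (not ∘ S t)

  graft : (t : OutTree D) {w u v : Fin (n D)} → ¬ T (S t w) → Graft t w u v → T (arc D u v) → OutTree D
  graft t {w} {u} {v} w∉ g uv = record
    { S = S t ∪｛ w ｝
    ; A = A′
    ; A⊆D = λ i j → [ A⊆D t i j , (λ { (refl , refl) → uv }) ] ∘ ⇒-elim
    ; A-tail = λ i j → [ ∪-old ∘ A-tail t i j , (λ { (refl , refl) → proj₁ (ends∈ g) }) ] ∘ ⇒-elim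
    ; A-head = λ i j → [ ∪-old ∘ A-head t i j , (λ { (refl , refl) → proj₂ (ends∈ g) }) ] ∘ ⇒-elim
    ; noLoop = λ i → ¬T⇒≡false (no-loop {i})
    ; noDigon = λ i j ij → ¬T⇒≡false (no-digon ij)
    ; connected = λ a b a∈ b∈ → to-old-end a∈ ++ reverse (to-old-end b∈)
    ; edges = edges′
    ; root = graft-root g
    ; root∈S = graft-root∈ g
    ; rootInDeg0 = graft-rootInDeg0 w∉ g
    ; rootUnique = graft-rootUnique w∉ g
    }
    where
    A′ : Fin (n D) → Fin (n D) → Bool
    A′ = A t ∪｛ u ⇒ v ｝

    no-loop : ∀ {i} → ¬ T (A′ i i)
    no-loop {i} ii with ⇒-elim ii
    ... | inj₁ old = ≡false⇒¬T (noLoop t i) old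
    ... | inj₂ (i≡u , i≡v) = ends-≢ w∉ g (trans (sym i≡u) i≡v)

    no-digon : ∀ {i j} → T (A′ i j) → ¬ T (A′ j i)
    no-digon ij ji with ⇒-elim ij | ⇒-elim ji
    ... | inj₁ old | inj₁ old′ = ≡false⇒¬T (noDigon t _ _ old) old′
    ... | inj₁ old | inj₂ (refl , refl) = not-both-old w∉ g (A-head t _ _ old) (A-tail t _ _ old)
    ... | inj₂ (refl , refl) | inj₁ old′ = not-both-old w∉ g (A-head t _ _ old′) (A-tail t _ _ old′)
    ... | inj₂ (refl , refl) | inj₂ (v≡u , _) = ends-≢ w∉ g (sym v≡u)

    to-old-end : ∀ {a} → T ((S t ∪｛ w ｝) a) → UWalk A′ a (old-end g)
    to-old-end a∈ with ∪-elim {X = S t} a∈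
    ... | inj₁ a∈S = UWalk-map ⇒-old (connected t _ _ a∈S (old-end∈ g))
    ... | inj₂ refl = link g

    edges′ : arcCount A′ + 1 ≡ count (S t ∪｛ w ｝)
    edges′ = begin
      arcCount A′ + 1           ≡⟨ cong (_+ 1) (arcCount-∪ {E = A t} uv-new) ⟩
      suc (arcCount (A t) + 1)  ≡⟨ cong suc (edges t) ⟩
      suc (count (S t))         ≡⟨ count-∪ (S t) w∉ ⟨
      count (S t ∪｛ w ｝)       ∎
      where
      open ≡-Reasoning
      uv-new : ¬ T (A t u v)
      uv-new uv∈ = not-both-old w∉ g (A-tail t u v uv∈) (A-head t u v uv∈)

  graft-leaves : (t : OutTree D) {w u v : Fin (n D)} (w∉ : ¬ T (S t w)) (g : Graft t w u v) (uv : T (arc D u v)) →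
    leaves t ≤ leaves (graft t w∉ g uv)
  graft-leaves t {w} w∉ (asLeaf {o} o∈) uv =
    count-exchange {f = isLeaf (S t) (A t)} {g = isLeaf (S t ∪｛ w ｝) (A t ∪｛ o ⇒ w ｝)}
      (λ i i≢o → isLeaf-∪ i≢o) (w∉ ∘ proj₁ ∘ T-∧ .to) new-leaf
    where
    new-leaf : T (isLeaf (S t ∪｛ w ｝) (A t ∪｛ o ⇒ w ｝) w)
    new-leaf = T-∧ .from (∪-here {X = S t} , outDeg0-intro {E = A t ∪｛ o ⇒ w ｝} λ j wj →
      [ w∉ ∘ A-tail t w j , (λ (w≡o , _) → w∉ (subst (T ∘ S t) (sym w≡o) o∈)) ] (⇒-elim {E = A t} wj))
  graft-leaves t {w} w∉ asRoot uv =
    count-mono {f = isLeaf (S t) (A t)} {g = isLeaf (S t ∪｛ w ｝) (A t ∪｛ w ⇒ root t ｝)}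
      λ i leaf → isLeaf-∪ (λ { refl → w∉ (proj₁ (T-∧ .to leaf)) }) leaf

  graft-growth : (t : OutTree D) {w u v : Fin (n D)} → ¬ T (S t w) → Graft t w u v → T (arc D u v) →
    Σ (OutTree D) λ t′ → missing t′ < missing t × leaves t ≤ leaves t′
  graft-growth t w∉ g uv = graft t w∉ g uv , ≤-reflexive (count-not-∪ (S t) w∉) , graft-leaves t w∉ g uv

-- Growing an out-tree into an out-branching

module _ {D : Digraph} (cc : ComponentCondition D) where

  outside-in-neighbour-of-root : (t : OutTree D) → Closed D (S t) →
    ∀ {a} → Reach D a (root t) → ¬ T (S t a) → ∃ λ x → ¬ T (S t x) × T (arc D x (root t))
  outside-in-neighbour-of-root t closed a↝r a∉ =
    let u , v , u∉ , v∈ , uv , v↝r = entering-arc a↝r a∉ (root∈S t)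
        u≁v : ¬ SameComp D u v
        u≁v = λ (_ , v↝u) → u∉ (Reach-closed closed v↝u v∈)
        x , (_ , x↝u) , xr = cc u v uv u≁v (root t) (v↝r , root-reaches t v∈)
    in x , (λ x∈ → u∉ (Reach-closed closed x↝u x∈)) , xr

  module _ (B : OutTree D) (B-spans : IsOutBranching B) where

    grow : (t : OutTree D) → ∀ {z} → ¬ T (S t z) →
      Σ (OutTree D) λ t′ → missing t′ < missing t × leaves t ≤ leaves t′
    grow t {z} z∉ with leaving-arc-or-closed {X = S t}
    ... | inj₁ (u , v , u∈ , v∉ , uv) = graft-growth t v∉ (asLeaf u∈) uv
    ... | inj₂ closed =
      let x , x∉ , xr = outside-in-neighbour-of-root t closed (root-reaches B (B-spans (root t))) rootB∉
      in graft-growth t x∉ asRoot xr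
      where
      rootB∉ : ¬ T (S t (root B))
      rootB∉ rootB∈ = z∉ (Reach-closed closed (root-reaches B (B-spans z)) rootB∈)

    extend : (t : OutTree D) → Acc _<_ (missing t) →
      Σ (OutTree D) λ t′ → IsOutBranching t′ × leaves t ≤ leaves t′
    extend t (acc smaller) with all? (λ v → T? (S t v))
    ... | yes spans = t , spans , ≤-refl
    ... | no ¬spans =
      let z , z∉ = ¬∀⟶∃¬ _ _ (λ v → T? (S t v)) ¬spans
          t′ , fewer , more = grow t z∉
          t″ , spans , more′ = extend t′ (smaller fewer)
      in t″ , spans , ≤-trans more more′

    extend-to-out-branching : (t : OutTree D) → Σ (OutTree D) λ t′ → IsOutBranching t′ × leaves t ≤ leaves t′
    extend-to-out-branching t = extend t (<-wellFounded (missing t))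

proposition3p1 : (D : Digraph) → ComponentCondition D → In𝓛 D
proposition3p1 D cc s k (inj₁ (_ , s≡0)) _ = inj₁ s≡0
proposition3p1 D cc s k (inj₂ ((B , B-spans , B-leaves) , B-max)) ((T₀ , T₀-leaves) , T-max) =
  inj₂ (≤-antisym s≤k k≤s)
  where
  open ≤-Reasoning
  s≤k : s ≤ k
  s≤k = subst (_≤ k) B-leaves (T-max B)
  k≤s : k ≤ s
  k≤s with extend-to-out-branching cc B B-spans T₀
  ... | T₁ , T₁-spans , T₀≤T₁ = begin
    k          ≡⟨ T₀-leaves ⟨
    leaves T₀  ≤⟨ T₀≤T₁ ⟩
    leaves T₁  ≤⟨ B-max T₁ T₁-spans ⟩
    s          ∎
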